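{- Let $p>3$ be prime, $n\ge0$ an integer, and $q(z)=a_3z^3+a_2z^2+a_1z+a_0$ with integer coefficients such that $p\mid a_3$ and $p\nmid a_2$. Then $|S(q,n)|=p^{n/2}$.
   Context: $S(q,n)=\sum_{z=1}^{p^n}e\!\left(\frac{q(z)}{p^n}\right)$, where $e(x)=e^{2\pi ix}$. -}

module Defs where

open import Data.Nat as ℕ using (ℕ; zero; suc)
open import Data.Integer using (ℤ; +_; _+_; _*_; -_; _-_)
open import Data.Integer.DivMod using (_%ℕ_)
open import Data.List using (List; []; _∷_; map; replicate; _++_; foldr; upTo)
open import Data.Product using (∃)
open import Relation.Binary.PropositionalEquality using (_≡_)

-- Integer polynomials as coefficient lists (constant term first).
Poly : Set
Poly = List ℤ

coeff : Poly → ℕ → ℤ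
coeff []       _       = + 0
coeff (a ∷ f)  zero    = a
coeff (a ∷ f)  (suc k) = coeff f k

infixl 6 _+ₚ_
infixl 7 _*ₚ_

_+ₚ_ : Poly → Poly → Poly
[]      +ₚ g       = g
(a ∷ f) +ₚ []      = a ∷ f
(a ∷ f) +ₚ (b ∷ g) = (a + b) ∷ (f +ₚ g)

_*ₚ_ : Poly → Poly → Poly
[]      *ₚ g = []
(a ∷ f) *ₚ g = map (a *_) g +ₚ (+ 0 ∷ (f *ₚ g))

mono : ℕ → Poly
mono k = replicate k (+ 0) ++ (+ 1 ∷ [])

const : ℤ → Poly
const c = c ∷ []

sumₚ : List Poly → Poly
sumₚ = foldr _+ₚ_ []

cyclotomicPrimePower : ℕ → ℕ → Poly
cyclotomicPrimePower p zero    = - (+ 1) ∷ + 1 ∷ []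
cyclotomicPrimePower p (suc m) = sumₚ (map (λ j → mono (j ℕ.* p ℕ.^ m)) (upTo p))

-- Equality in ℤ[ζ_{p^n}] ≅ ℤ[x]/(Φ_{p^n}), ζ = e(1/p^n) ↦ x:
-- f(ζ) = g(ζ)  iff  Φ_{p^n} divides f - g in ℤ[x].
_≈[_^_]_ : Poly → ℕ → ℕ → Poly → Set
f ≈[ p ^ n ] g =
  ∃ λ h → ∀ k → coeff f k - coeff g k ≡ coeff (cyclotomicPrimePower p n *ₚ h) k

-- residue of an integer modulo N (N ≥ 1 in all uses; junk value 0 for N = 0)
reduce : ℤ → ℕ → ℕ
reduce i zero    = 0
reduce i (suc m) = i %ℕ suc m

cubic : ℤ → ℤ → ℤ → ℤ → ℤ → ℤ
cubic a₃ a₂ a₁ a₀ z = a₃ * (z * z * z) + a₂ * (z * z) + a₁ * z + a₀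

-- e(t/p^n) = ζ^(t mod p^n) represented by the monomial x^(t mod p^n).
e : ℕ → ℕ → ℤ → Poly
e p n t = mono (reduce t (p ℕ.^ n))

-- S(q,n) = Σ_{z=1}^{p^n} e(q(z)/p^n), as an element of ℤ[ζ_{p^n}]
S : ℕ → (ℤ → ℤ) → ℕ → Poly
S p q n = sumₚ (map (λ z → e p n (q (+ suc z))) (upTo (p ℕ.^ n)))

-- complex conjugate of S(q,n): Σ_{z=1}^{p^n} e(-q(z)/p^n)
conjS : ℕ → (ℤ → ℤ) → ℕ → Poly
conjS p q n = sumₚ (map (λ z → e p n (- q (+ suc z))) (upTo (p ℕ.^ n)))

-- |S(q,n)|² = S(q,n)·conj(S(q,n))
absSq : ℕ → (ℤ → ℤ) → ℕ → Poly
absSq p q n = S p q n *ₚ conjS p q n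

{-# OPTIONS --safe #-}
module Submission where

-- Write ζ for a primitive pⁿ-th root of unity. Then S·conj(S) = Σ_{z,w} ζ^(q(z) − q(w)), and
-- substituting w = z + t turns it into Σ_t Σ_z ζ^(q(z) − q(z + t)), whose term t = 0 is pⁿ.
-- For 0 < t = pᵏv with p ∤ v, write z = x + c(j + p y) with c = p^(n−1−k). As p ∣ a₃, the
-- exponent is then congruent mod pⁿ to b(x, y) + j·(−2a₂v)·p^(n−1). Since −2a₂v is a unit modulo
-- p, the terms with j < p are the ζ^(s + l p^(n−1)) for l < p, each once, adding up to
-- ζ^s Φ_{pⁿ}(ζ) = 0.

open import Defs
open import Data.Nat as ℕ using (ℕ; zero; suc; _<_; _≤_; s≤s; z≤n; _^_; _∸_)
import Data.Nat.Properties as ℕP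
import Data.Nat.DivMod as ℕDM
open import Data.Integer as ℤ using (ℤ; +_; -[1+_]; _+_; _*_; -_; _-_)
import Data.Integer.Properties as ℤP
open import Data.Integer.Divisibility.Signed as Signed using (divides; ∣m∣n⇒∣m+n; ∣m⇒∣-m; ∣n⇒∣m*n; ∣m⇒∣m*n; *-monoˡ-∣)
open import Data.Integer.DivMod using (_/ℕ_; n%ℕd<d; a≡a%ℕn+[a/ℕn]*n)
import Data.Nat.Divisibility as ℕ∣
open import Data.Integer.Divisibility using (_∣_)
open import Data.Nat.Coprimality using (Coprime; coprime-Bézout)
open import Data.Nat.GCD using (module Bézout)
open import Data.Nat.Primality using (Prime; prime⇒irreducible; euclidsLemma)
open import Data.Product using (Σ; _×_; _,_; proj₁; proj₂)
open import Data.Integer.Tactic.RingSolver using (solve-∀)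
import Data.Nat.Tactic.RingSolver as ℕS
open import Data.List using ([]; _∷_; map; applyUpTo; upTo)
import Data.List.Properties as LP
open import Function using (_∘_)
open import Relation.Binary.PropositionalEquality
open import Relation.Binary.Bundles using (Setoid)
import Relation.Binary.Reasoning.Setoid as SetoidReasoning
open import Relation.Nullary using (¬_; yes; no)
open import Data.Empty using (⊥-elim)
open import Data.Sum using (inj₁; inj₂)

-- Polynomials up to trailing zeros

infix 4 _≋_
record _≋_ (f g : Poly) : Set where
  constructor coeffwise
  field coeff-≡ : ∀ k → coeff f k ≡ coeff g k
open _≋_

≋-refl : ∀ {f} → f ≋ f
≋-refl = coeffwise λ _ → refl

≋-sym : ∀ {f g} → f ≋ g → g ≋ f
≋-sym (coeffwise e) = coeffwise (sym ∘ e)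

≋-trans : ∀ {f g h} → f ≋ g → g ≋ h → f ≋ h
≋-trans (coeffwise e) (coeffwise e′) = coeffwise λ k → trans (e k) (e′ k)

coeff-+ₚ : ∀ f g k → coeff (f +ₚ g) k ≡ coeff f k + coeff g k
coeff-+ₚ []      g       k       = sym (ℤP.+-identityˡ _)
coeff-+ₚ (a ∷ f) []      k       = sym (ℤP.+-identityʳ _)
coeff-+ₚ (a ∷ f) (b ∷ g) zero    = refl
coeff-+ₚ (a ∷ f) (b ∷ g) (suc k) = coeff-+ₚ f g k

coeff-map : ∀ (φ : ℤ → ℤ) → φ (+ 0) ≡ + 0 → ∀ g k → coeff (map φ g) k ≡ φ (coeff g k)
coeff-map φ φ0 []      k       = sym φ0
coeff-map φ φ0 (b ∷ g) zero    = refl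
coeff-map φ φ0 (b ∷ g) (suc k) = coeff-map φ φ0 g k

coeff-*ₚ-∷ : ∀ a f g k → coeff ((a ∷ f) *ₚ g) k ≡ a * coeff g k + coeff (+ 0 ∷ f *ₚ g) k
coeff-*ₚ-∷ a f g k = trans (coeff-+ₚ (map (a *_) g) _ k)
                           (cong (_+ _) (coeff-map (a *_) (ℤP.*-zeroʳ a) g k))

coeff-*ₚ-[] : ∀ f k → coeff (f *ₚ []) k ≡ + 0
coeff-*ₚ-[] []      k       = refl
coeff-*ₚ-[] (a ∷ f) zero    = refl
coeff-*ₚ-[] (a ∷ f) (suc k) = coeff-*ₚ-[] f k

coeff-*ₚ-+ₚ : ∀ f g h k → coeff (f *ₚ (g +ₚ h)) k ≡ coeff (f *ₚ g) k + coeff (f *ₚ h) k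
coeff-*ₚ-+ₚ []      g h k = refl
coeff-*ₚ-+ₚ (a ∷ f) g h k = begin
  coeff ((a ∷ f) *ₚ (g +ₚ h)) k
    ≡⟨ coeff-*ₚ-∷ a f (g +ₚ h) k ⟩
  a * coeff (g +ₚ h) k + coeff (+ 0 ∷ f *ₚ (g +ₚ h)) k
    ≡⟨ cong₂ (λ x y → a * x + y) (coeff-+ₚ g h k) (shifted k) ⟩
  a * (coeff g k + coeff h k) + (coeff (+ 0 ∷ f *ₚ g) k + coeff (+ 0 ∷ f *ₚ h) k)
    ≡⟨ interchange a _ _ _ _ ⟩
  (a * coeff g k + coeff (+ 0 ∷ f *ₚ g) k) + (a * coeff h k + coeff (+ 0 ∷ f *ₚ h) k)
    ≡⟨ sym (cong₂ _+_ (coeff-*ₚ-∷ a f g k) (coeff-*ₚ-∷ a f h k)) ⟩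
  coeff ((a ∷ f) *ₚ g) k + coeff ((a ∷ f) *ₚ h) k ∎
  where
  open ≡-Reasoning
  shifted : ∀ k → coeff (+ 0 ∷ f *ₚ (g +ₚ h)) k ≡ coeff (+ 0 ∷ f *ₚ g) k + coeff (+ 0 ∷ f *ₚ h) k
  shifted zero    = refl
  shifted (suc k) = coeff-*ₚ-+ₚ f g h k
  interchange : ∀ a x y u v → a * (x + y) + (u + v) ≡ (a * x + u) + (a * y + v)
  interchange = solve-∀

coeff-*ₚ-neg : ∀ f h k → coeff (f *ₚ map -_ h) k ≡ - coeff (f *ₚ h) k
coeff-*ₚ-neg []      h k = refl
coeff-*ₚ-neg (a ∷ f) h k = begin
  coeff ((a ∷ f) *ₚ map -_ h) k
    ≡⟨ coeff-*ₚ-∷ a f (map -_ h) k ⟩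
  a * coeff (map -_ h) k + coeff (+ 0 ∷ f *ₚ map -_ h) k
    ≡⟨ cong₂ (λ x y → a * x + y) (coeff-map -_ refl h k) (shifted k) ⟩
  a * - coeff h k + - coeff (+ 0 ∷ f *ₚ h) k
    ≡⟨ negate a _ _ ⟩
  - (a * coeff h k + coeff (+ 0 ∷ f *ₚ h) k)
    ≡⟨ sym (cong -_ (coeff-*ₚ-∷ a f h k)) ⟩
  - coeff ((a ∷ f) *ₚ h) k ∎
  where
  open ≡-Reasoning
  shifted : ∀ k → coeff (+ 0 ∷ f *ₚ map -_ h) k ≡ - coeff (+ 0 ∷ f *ₚ h) k
  shifted zero    = refl
  shifted (suc k) = coeff-*ₚ-neg f h k
  negate : ∀ a x u → a * - x + - u ≡ - (a * x + u)
  negate = solve-∀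

coeff-+ₚ-*ₚ : ∀ f g h k → coeff ((f +ₚ g) *ₚ h) k ≡ coeff (f *ₚ h) k + coeff (g *ₚ h) k
coeff-+ₚ-*ₚ []      g       h k = sym (ℤP.+-identityˡ _)
coeff-+ₚ-*ₚ (a ∷ f) []      h k = sym (ℤP.+-identityʳ _)
coeff-+ₚ-*ₚ (a ∷ f) (b ∷ g) h k = begin
  coeff ((a + b ∷ f +ₚ g) *ₚ h) k
    ≡⟨ coeff-*ₚ-∷ (a + b) (f +ₚ g) h k ⟩
  (a + b) * coeff h k + coeff (+ 0 ∷ (f +ₚ g) *ₚ h) k
    ≡⟨ cong (λ y → (a + b) * coeff h k + y) (shifted k) ⟩
  (a + b) * coeff h k + (coeff (+ 0 ∷ f *ₚ h) k + coeff (+ 0 ∷ g *ₚ h) k)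
    ≡⟨ interchange a b _ _ _ ⟩
  (a * coeff h k + coeff (+ 0 ∷ f *ₚ h) k) + (b * coeff h k + coeff (+ 0 ∷ g *ₚ h) k)
    ≡⟨ sym (cong₂ _+_ (coeff-*ₚ-∷ a f h k) (coeff-*ₚ-∷ b g h k)) ⟩
  coeff ((a ∷ f) *ₚ h) k + coeff ((b ∷ g) *ₚ h) k ∎
  where
  open ≡-Reasoning
  shifted : ∀ k → coeff (+ 0 ∷ (f +ₚ g) *ₚ h) k ≡ coeff (+ 0 ∷ f *ₚ h) k + coeff (+ 0 ∷ g *ₚ h) k
  shifted zero    = refl
  shifted (suc k) = coeff-+ₚ-*ₚ f g h k
  interchange : ∀ a b x u v → (a + b) * x + (u + v) ≡ (a * x + u) + (b * x + v)
  interchange = solve-∀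

coeff-1*ₚ : ∀ g k → coeff (mono 0 *ₚ g) k ≡ coeff g k
coeff-1*ₚ g k = trans (coeff-*ₚ-∷ (+ 1) [] g k) (trans (cong (λ y → + 1 * coeff g k + y) (vanish k))
                  (trans (ℤP.+-identityʳ _) (ℤP.*-identityˡ _)))
  where
  vanish : ∀ k → coeff (+ 0 ∷ []) k ≡ + 0
  vanish zero    = refl
  vanish (suc k) = refl

coeff-x*ₚ : ∀ a g k → coeff (mono (suc a) *ₚ g) k ≡ coeff (+ 0 ∷ mono a *ₚ g) k
coeff-x*ₚ a g k = trans (coeff-*ₚ-∷ (+ 0) (mono a) g k) (ℤP.+-identityˡ _)

mono-*ₚ-mono : ∀ a b → mono a *ₚ mono b ≋ mono (a ℕ.+ b)
mono-*ₚ-mono a b = coeffwise (coeffs a)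
  where
  coeffs : ∀ a k → coeff (mono a *ₚ mono b) k ≡ coeff (mono (a ℕ.+ b)) k
  coeffs zero    k       = coeff-1*ₚ (mono b) k
  coeffs (suc a) zero    = coeff-x*ₚ a (mono b) 0
  coeffs (suc a) (suc k) = trans (coeff-x*ₚ a (mono b) (suc k)) (coeffs a k)

∑ : ℕ → (ℕ → ℤ) → ℤ
∑ zero    f = + 0
∑ (suc n) f = f 0 + ∑ n (f ∘ suc)

infix 5 ∑
syntax ∑ n (λ i → f) = ∑[ i < n ] f

∑-cong : ∀ n {f g} → (∀ i → i < n → f i ≡ g i) → ∑ n f ≡ ∑ n g
∑-cong zero    eq = refl
∑-cong (suc n) eq = cong₂ _+_ (eq 0 (s≤s z≤n)) (∑-cong n λ i i<n → eq (suc i) (s≤s i<n))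

∑-zero : ∀ n → ∑[ i < n ] + 0 ≡ + 0
∑-zero zero    = refl
∑-zero (suc n) = trans (ℤP.+-identityˡ _) (∑-zero n)

∑-const : ∀ n c → ∑[ i < n ] c ≡ + n * c
∑-const zero    c = sym (ℤP.*-zeroˡ c)
∑-const (suc n) c = begin
  c + (∑[ i < n ] c)     ≡⟨ cong (_+_ c) (∑-const n c) ⟩
  c + + n * c            ≡⟨ cong (λ x → x + + n * c) (sym (ℤP.*-identityˡ c)) ⟩
  + 1 * c + + n * c      ≡⟨ sym (ℤP.*-distribʳ-+ c (+ 1) (+ n)) ⟩
  + suc n * c            ∎
  where open ≡-Reasoning

∑-+ : ∀ n f g → ∑[ i < n ] (f i + g i) ≡ ∑ n f + ∑ n g
∑-+ zero    f g = refl
∑-+ (suc n) f g = trans (cong (_+_ (f 0 + g 0)) (∑-+ n (f ∘ suc) (g ∘ suc)))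
                        (interchange (f 0) (g 0) (∑ n (f ∘ suc)) (∑ n (g ∘ suc)))
  where
  interchange : ∀ a b c d → (a + b) + (c + d) ≡ (a + c) + (b + d)
  interchange = solve-∀

∑-neg : ∀ n f → ∑[ i < n ] - f i ≡ - ∑ n f
∑-neg zero    f = refl
∑-neg (suc n) f = trans (cong (_+_ (- f 0)) (∑-neg n (f ∘ suc))) (sym (ℤP.neg-distrib-+ (f 0) _))

∑-minus : ∀ n f g → ∑[ i < n ] (f i - g i) ≡ ∑ n f - ∑ n g
∑-minus n f g = trans (∑-+ n f (-_ ∘ g)) (cong (_+_ (∑ n f)) (∑-neg n g))

∑-*ˡ : ∀ n c f → ∑[ i < n ] (c * f i) ≡ c * ∑ n f
∑-*ˡ zero    c f = sym (ℤP.*-zeroʳ c)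
∑-*ˡ (suc n) c f = trans (cong (_+_ (c * f 0)) (∑-*ˡ n c (f ∘ suc))) (sym (ℤP.*-distribˡ-+ c (f 0) _))

∑-*ʳ : ∀ n c f → ∑[ i < n ] (f i * c) ≡ ∑ n f * c
∑-*ʳ n c f = trans (∑-cong n λ i _ → ℤP.*-comm (f i) c) (trans (∑-*ˡ n c f) (ℤP.*-comm c _))

∑-swap : ∀ m n (f : ℕ → ℕ → ℤ) → ∑[ i < m ] ∑[ j < n ] f i j ≡ ∑[ j < n ] ∑[ i < m ] f i j
∑-swap zero    n f = sym (∑-zero n)
∑-swap (suc m) n f = trans (cong (_+_ (∑ n (f 0))) (∑-swap m n (f ∘ suc)))
                           (sym (∑-+ n (f 0) λ j → ∑[ i < m ] f (suc i) j))

∑-+-range : ∀ m n f → ∑ (m ℕ.+ n) f ≡ ∑ m f + (∑[ i < n ] f (m ℕ.+ i))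
∑-+-range zero    n f = sym (ℤP.+-identityˡ _)
∑-+-range (suc m) n f = trans (cong (_+_ (f 0)) (∑-+-range m n (f ∘ suc))) (sym (ℤP.+-assoc (f 0) _ _))

∑-*-range : ∀ a b f → ∑ (a ℕ.* b) f ≡ ∑[ y < b ] ∑[ x < a ] f (x ℕ.+ a ℕ.* y)
∑-*-range a zero    f rewrite ℕP.*-zeroʳ a = refl
∑-*-range a (suc b) f rewrite ℕP.*-suc a b = begin
  ∑ (a ℕ.+ a ℕ.* b) f
    ≡⟨ ∑-+-range a (a ℕ.* b) f ⟩
  ∑ a f + (∑[ i < a ℕ.* b ] f (a ℕ.+ i))
    ≡⟨ cong₂ _+_ (∑-cong a λ x _ → cong f (first x)) (∑-*-range a b (f ∘ (a ℕ.+_))) ⟩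
  (∑[ x < a ] f (x ℕ.+ a ℕ.* 0)) + (∑[ y < b ] ∑[ x < a ] f (a ℕ.+ (x ℕ.+ a ℕ.* y)))
    ≡⟨ cong (_+_ (∑[ x < a ] f (x ℕ.+ a ℕ.* 0))) (∑-cong b λ y _ → ∑-cong a λ x _ → cong f (rest x y)) ⟩
  (∑[ x < a ] f (x ℕ.+ a ℕ.* 0)) + (∑[ y < b ] ∑[ x < a ] f (x ℕ.+ a ℕ.* suc y)) ∎
  where
  open ≡-Reasoning
  first : ∀ x → x ≡ x ℕ.+ a ℕ.* 0
  first x = sym (trans (cong (x ℕ.+_) (ℕP.*-zeroʳ a)) (ℕP.+-identityʳ x))
  rest : ∀ x y → a ℕ.+ (x ℕ.+ a ℕ.* y) ≡ x ℕ.+ a ℕ.* suc y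
  rest x y = trans (shift a x (a ℕ.* y)) (cong (x ℕ.+_) (sym (ℕP.*-suc a y)))
    where
    shift : ∀ a x z → a ℕ.+ (x ℕ.+ z) ≡ x ℕ.+ (a ℕ.+ z)
    shift = ℕS.solve-∀

∑-telescope : ∀ n (f : ℕ → ℤ) → ∑[ j < n ] (f (suc j) - f j) ≡ f n - f 0
∑-telescope zero    f = sym (ℤP.+-inverseʳ (f 0))
∑-telescope (suc n) f = trans (cong (_+_ (f 1 - f 0)) (∑-telescope n (f ∘ suc))) (collapse (f 1) (f 0) (f (suc n)))
  where
  collapse : ∀ a b c → (a - b) + (c - a) ≡ c - b
  collapse = solve-∀

δ : ℕ → ℕ → ℤ
δ a b = coeff (mono a) b

δ-diag : ∀ a → δ a a ≡ + 1
δ-diag zero    = refl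
δ-diag (suc a) = δ-diag a

δ-off : ∀ {a b} → a ≢ b → δ a b ≡ + 0
δ-off {zero}  {zero}  a≢b = ⊥-elim (a≢b refl)
δ-off {zero}  {suc b} _   = refl
δ-off {suc a} {zero}  _   = refl
δ-off {suc a} {suc b} a≢b = δ-off (a≢b ∘ cong suc)

∑-δ : ∀ n a (f : ℕ → ℤ) → a < n → ∑[ j < n ] (δ a j * f j) ≡ f a
∑-δ (suc n) zero    f _         = begin
  + 1 * f 0 + (∑[ j < n ] (+ 0 * f (suc j)))  ≡⟨ cong₂ _+_ (ℤP.*-identityˡ (f 0)) (∑-zero n) ⟩
  f 0 + + 0                                   ≡⟨ ℤP.+-identityʳ (f 0) ⟩
  f 0                                         ∎
  where open ≡-Reasoning
∑-δ (suc n) (suc a) f (s≤s a<n) = trans (ℤP.+-identityˡ _) (∑-δ n a (f ∘ suc) a<n)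

record Permutation (n : ℕ) : Set where
  field
    to from     : ℕ → ℕ
    to-<        : ∀ i → i < n → to i < n
    from-<      : ∀ j → j < n → from j < n
    from∘to     : ∀ i → i < n → from (to i) ≡ i
    to∘from     : ∀ j → j < n → to (from j) ≡ j

∑-permute : ∀ n (π : Permutation n) (f : ℕ → ℤ) → ∑[ i < n ] f (Permutation.to π i) ≡ ∑ n f
∑-permute n π f = begin
  ∑[ i < n ] f (to i)                           ≡⟨ ∑-cong n (λ i i<n → sym (∑-δ n (to i) f (to-< i i<n))) ⟩
  ∑[ i < n ] ∑[ j < n ] (δ (to i) j * f j)      ≡⟨ ∑-swap n n _ ⟩
  ∑[ j < n ] ∑[ i < n ] (δ (to i) j * f j)      ≡⟨ ∑-cong n (λ j _ → ∑-*ʳ n (f j) λ i → δ (to i) j) ⟩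
  ∑[ j < n ] ((∑[ i < n ] δ (to i) j) * f j)    ≡⟨ ∑-cong n (λ j j<n → cong (_* f j) (hits-once j j<n)) ⟩
  ∑[ j < n ] (+ 1 * f j)                        ≡⟨ ∑-cong n (λ j _ → ℤP.*-identityˡ (f j)) ⟩
  ∑ n f                                         ∎
  where
  open ≡-Reasoning
  open Permutation π
  δ-transpose : ∀ i j → i < n → j < n → δ (to i) j ≡ δ (from j) i
  δ-transpose i j i<n j<n with to i ℕ.≟ j
  ... | yes refl    = trans (δ-diag (to i)) (sym (trans (cong (λ k → δ k i) (from∘to i i<n)) (δ-diag i)))
  ... | no to-i≢j = trans (δ-off to-i≢j)
                            (sym (δ-off λ from-j≡i → to-i≢j (trans (cong to (sym from-j≡i)) (to∘from j j<n))))
  hits-once : ∀ j → j < n → ∑[ i < n ] δ (to i) j ≡ + 1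
  hits-once j j<n = trans (∑-cong n λ i i<n → trans (δ-transpose i j i<n j<n) (sym (ℤP.*-identityʳ _)))
                          (∑-δ n (from j) (λ _ → + 1) (from-< j j<n))

∑ₚ : ℕ → (ℕ → Poly) → Poly
∑ₚ zero    F = []
∑ₚ (suc n) F = F 0 +ₚ ∑ₚ n (F ∘ suc)

infix 5 ∑ₚ
syntax ∑ₚ n (λ i → F) = ∑ₚ[ i < n ] F

sumₚ-applyUpTo : ∀ (F : ℕ → Poly) n → sumₚ (applyUpTo F n) ≡ ∑ₚ n F
sumₚ-applyUpTo F zero    = refl
sumₚ-applyUpTo F (suc n) = cong (F 0 +ₚ_) (sumₚ-applyUpTo (F ∘ suc) n)

sumₚ-map-upTo : ∀ (F : ℕ → Poly) n → sumₚ (map F (upTo n)) ≡ ∑ₚ n F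
sumₚ-map-upTo F n = trans (cong sumₚ (LP.map-upTo F n)) (sumₚ-applyUpTo F n)

coeff-∑ₚ : ∀ n F k → coeff (∑ₚ n F) k ≡ ∑[ i < n ] coeff (F i) k
coeff-∑ₚ zero    F k = refl
coeff-∑ₚ (suc n) F k = trans (coeff-+ₚ (F 0) _ k) (cong (_+_ (coeff (F 0) k)) (coeff-∑ₚ n (F ∘ suc) k))

coeff-∑ₚ-*ₚ : ∀ n F h k → coeff (∑ₚ n F *ₚ h) k ≡ ∑[ i < n ] coeff (F i *ₚ h) k
coeff-∑ₚ-*ₚ zero    F h k = refl
coeff-∑ₚ-*ₚ (suc n) F h k = trans (coeff-+ₚ-*ₚ (F 0) _ h k) (cong (_+_ (coeff (F 0 *ₚ h) k)) (coeff-∑ₚ-*ₚ n (F ∘ suc) h k))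

coeff-*ₚ-∑ₚ : ∀ f n G k → coeff (f *ₚ ∑ₚ n G) k ≡ ∑[ i < n ] coeff (f *ₚ G i) k
coeff-*ₚ-∑ₚ f zero    G k = coeff-*ₚ-[] f k
coeff-*ₚ-∑ₚ f (suc n) G k = trans (coeff-*ₚ-+ₚ f (G 0) _ k) (cong (_+_ (coeff (f *ₚ G 0) k)) (coeff-*ₚ-∑ₚ f n (G ∘ suc) k))

∑ₚ-cong : ∀ n {F G} → (∀ i → i < n → F i ≋ G i) → ∑ₚ n F ≋ ∑ₚ n G
∑ₚ-cong n F≋G = coeffwise λ k →
  trans (coeff-∑ₚ n _ k) (trans (∑-cong n λ i i<n → coeff-≡ (F≋G i i<n) k) (sym (coeff-∑ₚ n _ k)))

∑ₚ-zero : ∀ n → ∑ₚ[ i < n ] [] ≋ []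
∑ₚ-zero n = coeffwise λ k → trans (coeff-∑ₚ n _ k) (∑-zero n)

∑ₚ-swap : ∀ m n (F : ℕ → ℕ → Poly) → ∑ₚ[ i < m ] ∑ₚ[ j < n ] F i j ≋ ∑ₚ[ j < n ] ∑ₚ[ i < m ] F i j
∑ₚ-swap m n F = coeffwise λ k → begin
  coeff (∑ₚ[ i < m ] ∑ₚ[ j < n ] F i j) k      ≡⟨ coeff-∑ₚ m _ k ⟩
  ∑[ i < m ] coeff (∑ₚ[ j < n ] F i j) k       ≡⟨ ∑-cong m (λ i _ → coeff-∑ₚ n _ k) ⟩
  ∑[ i < m ] ∑[ j < n ] coeff (F i j) k        ≡⟨ ∑-swap m n _ ⟩
  ∑[ j < n ] ∑[ i < m ] coeff (F i j) k        ≡⟨ ∑-cong n (λ j _ → coeff-∑ₚ m _ k) ⟨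
  ∑[ j < n ] coeff (∑ₚ[ i < m ] F i j) k       ≡⟨ coeff-∑ₚ n _ k ⟨
  coeff (∑ₚ[ j < n ] ∑ₚ[ i < m ] F i j) k      ∎
  where open ≡-Reasoning

∑ₚ-*-range : ∀ a b F → ∑ₚ (a ℕ.* b) F ≋ ∑ₚ[ y < b ] ∑ₚ[ x < a ] F (x ℕ.+ a ℕ.* y)
∑ₚ-*-range a b F = coeffwise λ k → begin
  coeff (∑ₚ (a ℕ.* b) F) k                               ≡⟨ coeff-∑ₚ (a ℕ.* b) F k ⟩
  ∑[ i < a ℕ.* b ] coeff (F i) k                         ≡⟨ ∑-*-range a b _ ⟩
  ∑[ y < b ] ∑[ x < a ] coeff (F (x ℕ.+ a ℕ.* y)) k      ≡⟨ ∑-cong b (λ y _ → coeff-∑ₚ a _ k) ⟨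
  ∑[ y < b ] coeff (∑ₚ[ x < a ] F (x ℕ.+ a ℕ.* y)) k     ≡⟨ coeff-∑ₚ b _ k ⟨
  coeff (∑ₚ[ y < b ] ∑ₚ[ x < a ] F (x ℕ.+ a ℕ.* y)) k    ∎
  where open ≡-Reasoning

∑ₚ-permute : ∀ n (π : Permutation n) F → ∑ₚ[ i < n ] F (Permutation.to π i) ≋ ∑ₚ n F
∑ₚ-permute n π F = coeffwise λ k →
  trans (coeff-∑ₚ n _ k) (trans (∑-permute n π λ i → coeff (F i) k) (sym (coeff-∑ₚ n F k)))

∑ₚ-*ₚ-∑ₚ : ∀ m n F G → ∑ₚ m F *ₚ ∑ₚ n G ≋ ∑ₚ[ i < m ] ∑ₚ[ j < n ] (F i *ₚ G j)
∑ₚ-*ₚ-∑ₚ m n F G = coeffwise λ k → begin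
  coeff (∑ₚ m F *ₚ ∑ₚ n G) k                      ≡⟨ coeff-∑ₚ-*ₚ m F _ k ⟩
  ∑[ i < m ] coeff (F i *ₚ ∑ₚ n G) k              ≡⟨ ∑-cong m (λ i _ → coeff-*ₚ-∑ₚ (F i) n G k) ⟩
  ∑[ i < m ] ∑[ j < n ] coeff (F i *ₚ G j) k      ≡⟨ ∑-cong m (λ i _ → coeff-∑ₚ n _ k) ⟨
  ∑[ i < m ] coeff (∑ₚ[ j < n ] (F i *ₚ G j)) k   ≡⟨ coeff-∑ₚ m _ k ⟨
  coeff (∑ₚ[ i < m ] ∑ₚ[ j < n ] (F i *ₚ G j)) k  ∎
  where open ≡-Reasoning

infix 4 _≈_mod_
record _≈_mod_ (f g Ψ : Poly) : Set where
  constructor differ-by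
  field
    quotient : Poly
    equality : ∀ k → coeff f k - coeff g k ≡ coeff (Ψ *ₚ quotient) k

≋⇒≈ : ∀ {f g Ψ} → f ≋ g → f ≈ g mod Ψ
≋⇒≈ {f} {g} {Ψ} (coeffwise f≋g) = differ-by [] λ k →
  trans (cong (_- coeff g k) (f≋g k)) (trans (ℤP.+-inverseʳ (coeff g k)) (sym (coeff-*ₚ-[] Ψ k)))

≈-refl : ∀ {f Ψ} → f ≈ f mod Ψ
≈-refl = ≋⇒≈ ≋-refl

≈-trans : ∀ {f g h Ψ} → f ≈ g mod Ψ → g ≈ h mod Ψ → f ≈ h mod Ψ
≈-trans {f} {g} {h} {Ψ} (differ-by h₁ eq₁) (differ-by h₂ eq₂) = differ-by (h₁ +ₚ h₂) λ k →
  trans (split (coeff f k) (coeff g k) (coeff h k)) (trans (cong₂ _+_ (eq₁ k) (eq₂ k)) (sym (coeff-*ₚ-+ₚ Ψ h₁ h₂ k)))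
  where
  split : ∀ a b c → a - c ≡ (a - b) + (b - c)
  split = solve-∀

≈-+ₚ : ∀ {f₁ g₁ f₂ g₂ Ψ} → f₁ ≈ g₁ mod Ψ → f₂ ≈ g₂ mod Ψ → f₁ +ₚ f₂ ≈ g₁ +ₚ g₂ mod Ψ
≈-+ₚ {f₁} {g₁} {f₂} {g₂} {Ψ} (differ-by h₁ eq₁) (differ-by h₂ eq₂) = differ-by (h₁ +ₚ h₂) λ k → begin
  coeff (f₁ +ₚ f₂) k - coeff (g₁ +ₚ g₂) k
    ≡⟨ cong₂ _-_ (coeff-+ₚ f₁ f₂ k) (coeff-+ₚ g₁ g₂ k) ⟩
  (coeff f₁ k + coeff f₂ k) - (coeff g₁ k + coeff g₂ k)
    ≡⟨ interchange (coeff f₁ k) (coeff f₂ k) (coeff g₁ k) (coeff g₂ k) ⟩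
  (coeff f₁ k - coeff g₁ k) + (coeff f₂ k - coeff g₂ k)
    ≡⟨ cong₂ _+_ (eq₁ k) (eq₂ k) ⟩
  coeff (Ψ *ₚ h₁) k + coeff (Ψ *ₚ h₂) k
    ≡⟨ coeff-*ₚ-+ₚ Ψ h₁ h₂ k ⟨
  coeff (Ψ *ₚ (h₁ +ₚ h₂)) k ∎
  where
  open ≡-Reasoning
  interchange : ∀ a b c d → (a + b) - (c + d) ≡ (a - c) + (b - d)
  interchange = solve-∀

≈-∑ₚ : ∀ n {F G Ψ} → (∀ i → i < n → F i ≈ G i mod Ψ) → ∑ₚ n F ≈ ∑ₚ n G mod Ψ
≈-∑ₚ zero    F≈G = ≈-refl
≈-∑ₚ (suc n) F≈G = ≈-+ₚ (F≈G 0 (s≤s z≤n)) (≈-∑ₚ n λ i i<n → F≈G (suc i) (s≤s i<n))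

∑ₚ≈head : ∀ n F {c Ψ} → 0 < n → F 0 ≈ c mod Ψ → (∀ t → 0 < t → t < n → F t ≈ [] mod Ψ) →
          ∑ₚ n F ≈ c mod Ψ
∑ₚ≈head (suc n) F {c} _ F0≈c F≈[] =
  ≈-trans (≈-+ₚ F0≈c (≈-∑ₚ n λ t t<n → F≈[] (suc t) (s≤s z≤n) (s≤s t<n)))
          (≋⇒≈ (coeffwise λ k → trans (coeff-+ₚ c _ k)
                                  (trans (cong (_+_ (coeff c k)) (coeff-≡ (∑ₚ-zero n) k)) (ℤP.+-identityʳ _))))

infix 4 _≡_mod_
record _≡_mod_ (a b : ℤ) (m : ℕ) : Set where
  constructor from-∣
  field ∣-difference : + m Signed.∣ a - b

≡mod-reflexive : ∀ {m a b} → a ≡ b → a ≡ b mod m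
≡mod-reflexive {m} {a} refl = from-∣ (divides (+ 0) (trans (ℤP.+-inverseʳ a) (sym (ℤP.*-zeroˡ (+ m)))))

≡mod-refl : ∀ {m} a → a ≡ a mod m
≡mod-refl a = ≡mod-reflexive refl

≡mod-sym : ∀ {m a b} → a ≡ b mod m → b ≡ a mod m
≡mod-sym {m} {a} {b} (from-∣ m∣a-b) = from-∣ (subst (+ m Signed.∣_) (flip a b) (∣m⇒∣-m m∣a-b))
  where
  flip : ∀ a b → - (a - b) ≡ b - a
  flip = solve-∀

≡mod-trans : ∀ {m a b c} → a ≡ b mod m → b ≡ c mod m → a ≡ c mod m
≡mod-trans {m} {a} {b} {c} (from-∣ m∣a-b) (from-∣ m∣b-c) =
  from-∣ (subst (+ m Signed.∣_) (join a b c) (∣m∣n⇒∣m+n m∣a-b m∣b-c))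
  where
  join : ∀ a b c → (a - b) + (b - c) ≡ a - c
  join = solve-∀

≡mod-setoid : ℕ → Setoid _ _
≡mod-setoid m = record
  { Carrier       = ℤ
  ; _≈_           = _≡_mod m
  ; isEquivalence = record { refl = ≡mod-refl _ ; sym = ≡mod-sym ; trans = ≡mod-trans }
  }

module ≡mod-Reasoning (m : ℕ) = SetoidReasoning (≡mod-setoid m)

≡mod-+ : ∀ {m a b c d} → a ≡ b mod m → c ≡ d mod m → a + c ≡ b + d mod m
≡mod-+ {m} {a} {b} {c} {d} (from-∣ m∣a-b) (from-∣ m∣c-d) =
  from-∣ (subst (+ m Signed.∣_) (interchange a b c d) (∣m∣n⇒∣m+n m∣a-b m∣c-d))
  where
  interchange : ∀ a b c d → (a - b) + (c - d) ≡ (a + c) - (b + d)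
  interchange = solve-∀

≡mod-neg : ∀ {m a b} → a ≡ b mod m → - a ≡ - b mod m
≡mod-neg {m} {a} {b} (from-∣ m∣a-b) = from-∣ (subst (+ m Signed.∣_) (distrib a b) (∣m⇒∣-m m∣a-b))
  where
  distrib : ∀ a b → - (a - b) ≡ - a - - b
  distrib = solve-∀

≡mod-minus : ∀ {m a b c d} → a ≡ b mod m → c ≡ d mod m → a - c ≡ b - d mod m
≡mod-minus a≡b c≡d = ≡mod-+ a≡b (≡mod-neg c≡d)

≡mod-*ˡ : ∀ {m a b} c → a ≡ b mod m → c * a ≡ c * b mod m
≡mod-*ˡ {m} {a} {b} c (from-∣ m∣a-b) = from-∣ (subst (+ m Signed.∣_) (distrib c a b) (∣n⇒∣m*n c m∣a-b))
  where
  distrib : ∀ c a b → c * (a - b) ≡ c * a - c * b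
  distrib = solve-∀

≡mod-*ʳ : ∀ {m a b} c → a ≡ b mod m → a * c ≡ b * c mod m
≡mod-*ʳ {m} {a} {b} c a≡b = subst₂ (_≡_mod m) (ℤP.*-comm c a) (ℤP.*-comm c b) (≡mod-*ˡ c a≡b)

≡mod-scale : ∀ {m a b} k → a ≡ b mod m → a * + k ≡ b * + k mod (m ℕ.* k)
≡mod-scale {m} {a} {b} k (from-∣ m∣a-b) =
  from-∣ (subst₂ Signed._∣_ (sym (ℤP.pos-* m k)) (distrib a b (+ k)) (*-monoˡ-∣ (+ k) m∣a-b))
  where
  distrib : ∀ a b k → (a - b) * k ≡ a * k - b * k
  distrib = solve-∀

reduce-< : ∀ m x → 0 < m → reduce x m < m
reduce-< (suc m) x _ = n%ℕd<d x (suc m)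

reduce-≡mod : ∀ m x → 0 < m → x ≡ + reduce x m mod m
reduce-≡mod (suc m) x _ = from-∣ (divides (x /ℕ suc m)
  (trans (cong (_- + reduce x (suc m)) (a≡a%ℕn+[a/ℕn]*n x (suc m))) (cancel (+ reduce x (suc m)) _)))
  where
  cancel : ∀ r k → (r + k) - r ≡ k
  cancel = solve-∀

m∣n∧n<m⇒n≡0 : ∀ {m n} → m ℕ∣.∣ n → n < m → n ≡ 0
m∣n∧n<m⇒n≡0 {n = zero}  _   _   = refl
m∣n∧n<m⇒n≡0 {n = suc n} m∣n n<m = ⊥-elim (ℕP.<⇒≱ n<m (ℕ∣.∣⇒≤ m∣n))

∣[+a]-[+b]∣< : ∀ {m a b} → a < m → b < m → ℤ.∣ + a - + b ∣ < m
∣[+a]-[+b]∣< {m} {a} {b} a<m b<m rewrite ℤP.[+m]-[+n]≡m⊖n a b with ℕP.≤-total a b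
... | inj₁ a≤b = ℕP.≤-<-trans (ℕP.≤-reflexive (ℤP.∣⊖∣-≤ a≤b)) (ℕP.≤-<-trans (ℕP.m∸n≤m b a) b<m)
... | inj₂ b≤a = ℕP.≤-<-trans (ℕP.≤-reflexive (trans (ℤP.∣m⊖n∣≡∣n⊖m∣ a b) (ℤP.∣⊖∣-≤ b≤a)))
                            (ℕP.≤-<-trans (ℕP.m∸n≤m a b) a<m)

≡mod⇒≡ : ∀ {m a b} → a < m → b < m → + a ≡ + b mod m → a ≡ b
≡mod⇒≡ {m} {a} {b} a<m b<m (from-∣ m∣a-b) =
  ℤP.+-injective (ℤP.i-j≡0⇒i≡j (+ a) (+ b)
    (ℤP.∣i∣≡0⇒i≡0 (m∣n∧n<m⇒n≡0 (Signed.∣⇒∣ᵤ m∣a-b) (∣[+a]-[+b]∣< a<m b<m))))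

reduce-unique : ∀ m x r → 0 < m → r < m → x ≡ + r mod m → reduce x m ≡ r
reduce-unique m x r 0<m r<m x≡r = ≡mod⇒≡ (reduce-< m x 0<m) r<m (≡mod-trans (≡mod-sym (reduce-≡mod m x 0<m)) x≡r)

reduce-cong : ∀ m x y → 0 < m → x ≡ y mod m → reduce x m ≡ reduce y m
reduce-cong m x y 0<m x≡y = reduce-unique m x (reduce y m) 0<m (reduce-< m y 0<m) (≡mod-trans x≡y (reduce-≡mod m y 0<m))

affine-permutation : ∀ m (d u w : ℤ) → 0 < m → u * w ≡ + 1 mod m → Permutation m
affine-permutation m d u w 0<m uw≡1 = record
  { to      = to
  ; from    = from
  ; to-<    = λ i _ → reduce-< m _ 0<m
  ; from-<  = λ j _ → reduce-< m _ 0<m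
  ; from∘to = λ i i<m → reduce-unique m _ i 0<m i<m (begin
      (+ to i - d) * w              ≈⟨ ≡mod-*ʳ w (≡mod-minus (≡mod-sym (reduce-≡mod m (d + + i * u) 0<m)) (≡mod-refl d)) ⟩
      (d + + i * u - d) * w         ≡⟨ cancel d (+ i) u w ⟩
      + i * (u * w)                 ≈⟨ ≡mod-*ˡ (+ i) uw≡1 ⟩
      + i * + 1                     ≡⟨ ℤP.*-identityʳ (+ i) ⟩
      + i                           ∎)
  ; to∘from = λ j j<m → reduce-unique m _ j 0<m j<m (begin
      d + + from j * u              ≈⟨ ≡mod-+ (≡mod-refl d) (≡mod-*ʳ u (≡mod-sym (reduce-≡mod m ((+ j - d) * w) 0<m))) ⟩
      d + (+ j - d) * w * u         ≡⟨ reassoc d (+ j - d) w u ⟩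
      d + (+ j - d) * (u * w)       ≈⟨ ≡mod-+ (≡mod-refl d) (≡mod-*ˡ (+ j - d) uw≡1) ⟩
      d + (+ j - d) * + 1           ≡⟨ uncancel d (+ j) ⟩
      + j                           ∎)
  }
  where
  to from : ℕ → ℕ
  to i   = reduce (d + + i * u) m
  from j = reduce ((+ j - d) * w) m
  open ≡mod-Reasoning m
  cancel : ∀ d i u w → (d + i * u - d) * w ≡ i * (u * w)
  cancel = solve-∀
  reassoc : ∀ d l w u → d + l * w * u ≡ d + l * (u * w)
  reassoc = solve-∀
  uncancel : ∀ d j → d + (j - d) * + 1 ≡ j
  uncancel = solve-∀

-- Powers of x modulo Φ_{pⁿ}

Φ : ℕ → ℕ → Poly
Φ = cyclotomicPrimePower

*ₚ≈[] : ∀ Ψ h → Ψ *ₚ h ≈ [] mod Ψ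
*ₚ≈[] Ψ h = differ-by h λ k → ℤP.+-identityʳ _

Φ-*ₚ-mono : ∀ p m s → Φ p (suc m) *ₚ mono s ≋ ∑ₚ[ j < p ] mono (j ℕ.* p ^ m ℕ.+ s)
Φ-*ₚ-mono p m s = coeffwise λ k → begin
  coeff (Φ p (suc m) *ₚ mono s) k
    ≡⟨ cong (λ f → coeff (f *ₚ mono s) k) (sumₚ-map-upTo (λ j → mono (j ℕ.* p ^ m)) p) ⟩
  coeff ((∑ₚ[ j < p ] mono (j ℕ.* p ^ m)) *ₚ mono s) k
    ≡⟨ coeff-∑ₚ-*ₚ p _ (mono s) k ⟩
  ∑[ j < p ] coeff (mono (j ℕ.* p ^ m) *ₚ mono s) k
    ≡⟨ ∑-cong p (λ j _ → coeff-≡ (mono-*ₚ-mono (j ℕ.* p ^ m) s) k) ⟩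
  ∑[ j < p ] δ (j ℕ.* p ^ m ℕ.+ s) k
    ≡⟨ coeff-∑ₚ p _ k ⟨
  coeff (∑ₚ[ j < p ] mono (j ℕ.* p ^ m ℕ.+ s)) k ∎
  where open ≡-Reasoning

mono-period : ∀ p n a → mono (a ℕ.+ p ^ n) ≈ mono a mod Φ p n
mono-period p zero a = differ-by (mono a) λ k → begin
  δ (a ℕ.+ 1) k - δ a k
    ≡⟨ cong (λ i → δ i k - δ a k) (ℕP.+-comm a 1) ⟩
  coeff (+ 0 ∷ mono a) k - δ a k
    ≡⟨ cong (_- δ a k) (shift k) ⟩
  coeff (+ 0 ∷ mono 0 *ₚ mono a) k - δ a k
    ≡⟨ reorder (coeff (+ 0 ∷ mono 0 *ₚ mono a) k) (δ a k) ⟩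
  - + 1 * δ a k + coeff (+ 0 ∷ mono 0 *ₚ mono a) k
    ≡⟨ coeff-*ₚ-∷ (- + 1) (mono 0) (mono a) k ⟨
  coeff (Φ p 0 *ₚ mono a) k ∎
  where
  open ≡-Reasoning
  shift : ∀ k → coeff (+ 0 ∷ mono a) k ≡ coeff (+ 0 ∷ mono 0 *ₚ mono a) k
  shift zero    = refl
  shift (suc k) = sym (coeff-1*ₚ (mono a) k)
  reorder : ∀ x y → x - y ≡ - + 1 * y + x
  reorder = solve-∀
mono-period p (suc m) a = differ-by (mono (a ℕ.+ M) +ₚ map -_ (mono a)) λ k → sym (begin
  coeff (Φ p (suc m) *ₚ (mono (a ℕ.+ M) +ₚ map -_ (mono a))) k
    ≡⟨ coeff-*ₚ-+ₚ (Φ p (suc m)) _ _ k ⟩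
  coeff (Φ p (suc m) *ₚ mono (a ℕ.+ M)) k + coeff (Φ p (suc m) *ₚ map -_ (mono a)) k
    ≡⟨ cong₂ _+_ (coeff-≡ (Φ-*ₚ-mono p m (a ℕ.+ M)) k)
                 (trans (coeff-*ₚ-neg (Φ p (suc m)) (mono a) k) (cong -_ (coeff-≡ (Φ-*ₚ-mono p m a) k))) ⟩
  coeff (∑ₚ[ j < p ] mono (j ℕ.* M ℕ.+ (a ℕ.+ M))) k - coeff (∑ₚ[ j < p ] mono (j ℕ.* M ℕ.+ a)) k
    ≡⟨ cong₂ _-_ (trans (coeff-∑ₚ p _ k) (∑-cong p λ j _ → cong (λ i → δ i k) (shift-index j M a))) (coeff-∑ₚ p _ k) ⟩
  (∑[ j < p ] g k (suc j)) - (∑[ j < p ] g k j)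
    ≡⟨ ∑-minus p (g k ∘ suc) (g k) ⟨
  ∑[ j < p ] (g k (suc j) - g k j)
    ≡⟨ ∑-telescope p (g k) ⟩
  g k p - g k 0
    ≡⟨ cong (λ i → δ i k - δ a k) (ℕP.+-comm (p ℕ.* M) a) ⟩
  δ (a ℕ.+ p ^ suc m) k - δ a k ∎)
  where
  open ≡-Reasoning
  M = p ^ m
  g : ℕ → ℕ → ℤ
  g k j = δ (j ℕ.* M ℕ.+ a) k
  shift-index : ∀ j M a → j ℕ.* M ℕ.+ (a ℕ.+ M) ≡ M ℕ.+ j ℕ.* M ℕ.+ a
  shift-index = ℕS.solve-∀

mono-period-* : ∀ p n a j → mono (a ℕ.+ j ℕ.* p ^ n) ≈ mono a mod Φ p n
mono-period-* p n a zero    rewrite ℕP.+-identityʳ a = ≈-refl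
mono-period-* p n a (suc j) =
  ≈-trans (subst (λ i → mono i ≈ mono (a ℕ.+ j ℕ.* p ^ n) mod Φ p n) (reassoc a j (p ^ n))
                 (mono-period p n (a ℕ.+ j ℕ.* p ^ n)))
          (mono-period-* p n a j)
  where
  reassoc : ∀ a j N → a ℕ.+ j ℕ.* N ℕ.+ N ≡ a ℕ.+ suc j ℕ.* N
  reassoc = ℕS.solve-∀

mono-≈-reduce : ∀ Ψ N → 0 < N → (∀ a j → mono (a ℕ.+ j ℕ.* N) ≈ mono a mod Ψ) →
                ∀ a → mono a ≈ mono (reduce (+ a) N) mod Ψ
mono-≈-reduce Ψ (suc m) _ period a =
  subst (λ i → mono i ≈ mono (a ℕ.% suc m) mod Ψ) (sym (ℕDM.m≡m%n+[m/n]*n a (suc m)))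
        (period (a ℕ.% suc m) (a ℕ./ suc m))

mono-cong : ∀ p n → 0 < p ^ n → ∀ a x → + a ≡ x mod p ^ n → mono a ≈ mono (reduce x (p ^ n)) mod Φ p n
mono-cong p n 0<N a x a≡x =
  subst (λ r → mono a ≈ mono r mod Φ p n) (reduce-cong (p ^ n) (+ a) x 0<N a≡x)
        (mono-≈-reduce (Φ p n) (p ^ n) 0<N (mono-period-* p n) a)

∑ₚ-progression≈[] : ∀ p m (g : ℕ → ℤ) (b u w : ℤ) → 0 < p → u * w ≡ + 1 mod p →
                    (∀ j → j < p → g j ≡ b + + j * u * + (p ^ m) mod p ^ suc m) →
                    ∑ₚ[ j < p ] e p (suc m) (g j) ≈ [] mod Φ p (suc m)
∑ₚ-progression≈[] p m g b u w 0<p uw≡1 g≡b+juM =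
  ≈-trans (≋⇒≈ (≋-trans (∑ₚ-cong p λ j j<p → coeffwise λ k → cong (λ r → δ r k) (reduce-g j j<p))
               (≋-trans (∑ₚ-permute p π λ l → mono (l ℕ.* M ℕ.+ s))
                        (≋-sym (Φ-*ₚ-mono p m s)))))
          (*ₚ≈[] (Φ p (suc m)) (mono s))
  where
  M N : ℕ
  M = p ^ m
  N = p ^ suc m
  0<M : 0 < M
  0<M = ℕP.m^n>0 p {{ℕ.>-nonZero 0<p}} m
  0<N : 0 < N
  0<N = ℕP.m^n>0 p {{ℕ.>-nonZero 0<p}} (suc m)
  instance
    M≢0 : ℕ.NonZero M
    M≢0 = ℕ.>-nonZero 0<M
  -- b ≡ d pᵐ + s, so g j ≡ (d + j u) pᵐ + s, and j ↦ d + j u permutes the residues mod p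
  r s d : ℕ
  r = reduce b N
  s = r ℕ.% M
  d = r ℕ./ M
  π : Permutation p
  π = affine-permutation p (+ d) u w 0<p uw≡1
  open Permutation π using (to)
  bound : ∀ j → to j ℕ.* M ℕ.+ s < N
  bound j = ℕP.<-≤-trans (ℕP.+-monoʳ-< (to j ℕ.* M) (ℕDM.m%n<n r M))
              (subst (_≤ N) (ℕP.+-comm M (to j ℕ.* M)) (ℕP.*-monoˡ-≤ M (reduce-< p _ 0<p)))
  r-split : + r ≡ + s + + d * + M
  r-split = trans (cong +_ (ℕDM.m≡m%n+[m/n]*n r M)) (trans (ℤP.pos-+ s (d ℕ.* M)) (cong (_+_ (+ s)) (ℤP.pos-* d M)))
  regroup : ∀ s d i M → (s + d * M) + i * M ≡ (d + i) * M + s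
  regroup = solve-∀
  reduce-g : ∀ j → j < p → reduce (g j) N ≡ to j ℕ.* M ℕ.+ s
  reduce-g j j<p = reduce-unique N (g j) _ 0<N (bound j) (begin
    g j                              ≈⟨ g≡b+juM j j<p ⟩
    b + + j * u * + M                ≈⟨ ≡mod-+ (reduce-≡mod N b 0<N) (≡mod-refl _) ⟩
    + r + + j * u * + M              ≡⟨ cong (_+ + j * u * + M) r-split ⟩
    + s + + d * + M + + j * u * + M  ≡⟨ regroup (+ s) (+ d) (+ j * u) (+ M) ⟩
    (+ d + + j * u) * + M + + s      ≈⟨ ≡mod-+ (≡mod-scale M (reduce-≡mod p (+ d + + j * u) 0<p)) (≡mod-refl (+ s)) ⟩
    + to j * + M + + s               ≡⟨ trans (cong (_+ + s) (sym (ℤP.pos-* (to j) M))) (sym (ℤP.pos-+ (to j ℕ.* M) s)) ⟩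
    + (to j ℕ.* M ℕ.+ s)             ∎)
    where open ≡mod-Reasoning N

-- Units modulo p and the p-part of an integer

prime∤⇒coprime : ∀ {p a} → Prime p → ¬ p ℕ∣.∣ a → Coprime p a
prime∤⇒coprime pp p∤a (d∣p , d∣a) with prime⇒irreducible pp d∣p
... | inj₁ d≡1 = d≡1
... | inj₂ refl = ⊥-elim (p∤a d∣a)

pos-+-* : ∀ d y n x m → d ℕ.+ y ℕ.* n ≡ x ℕ.* m → + d + + y * + n ≡ + x * + m
pos-+-* d y n x m eq = begin
  + d + + y * + n     ≡⟨ cong (_+_ (+ d)) (ℤP.pos-* y n) ⟨
  + d + + (y ℕ.* n)   ≡⟨ ℤP.pos-+ d (y ℕ.* n) ⟨
  + (d ℕ.+ y ℕ.* n)   ≡⟨ cong +_ eq ⟩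
  + (x ℕ.* m)         ≡⟨ ℤP.pos-* x m ⟩
  + x * + m           ∎
  where open ≡-Reasoning

inverse-mod-ℕ : ∀ {m a} → Coprime m a → Σ ℤ λ w → + a * w ≡ + 1 mod m
inverse-mod-ℕ {m} {a} m⊥a with coprime-Bézout m⊥a
... | Bézout.+- x y eq = - + y , from-∣ (divides (- + x) (begin
  + a * - + y - + 1       ≡⟨ regroup (+ a) (+ y) ⟩
  - (+ 1 + + y * + a)     ≡⟨ cong -_ (pos-+-* 1 y a x m eq) ⟩
  - (+ x * + m)           ≡⟨ ℤP.neg-distribˡ-* (+ x) (+ m) ⟩
  - + x * + m             ∎))
  where
  open ≡-Reasoning
  regroup : ∀ a y → a * - y - + 1 ≡ - (+ 1 + y * a)
  regroup = solve-∀
... | Bézout.-+ x y eq = + y , from-∣ (divides (+ x) (begin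
  + a * + y - + 1         ≡⟨ cong (_- + 1) (ℤP.*-comm (+ a) (+ y)) ⟩
  + y * + a - + 1         ≡⟨ cong (_- + 1) (pos-+-* 1 x m y a eq) ⟨
  + 1 + + x * + m - + 1   ≡⟨ cancel (+ x * + m) ⟩
  + x * + m               ∎))
  where
  open ≡-Reasoning
  cancel : ∀ z → + 1 + z - + 1 ≡ z
  cancel = solve-∀

inverse-mod : ∀ {m} u → Coprime m ℤ.∣ u ∣ → Σ ℤ λ w → u * w ≡ + 1 mod m
inverse-mod       (+ a)    m⊥a = inverse-mod-ℕ m⊥a
inverse-mod {m} -[1+ a ] m⊥a with inverse-mod-ℕ m⊥a
... | w , aw≡1 = - w , subst (λ z → z ≡ + 1 mod m) (sym (neg*neg (+ suc a) w)) aw≡1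
  where
  neg*neg : ∀ x w → - x * - w ≡ x * w
  neg*neg = solve-∀

prime-power-factor : ∀ {p} → Prime p → ∀ n t → 0 < t → t < p ^ n →
                     Σ ℕ λ k → Σ ℕ λ v → k < n × t ≡ p ^ k ℕ.* v × ¬ p ℕ∣.∣ v
prime-power-factor pp zero    t 0<t t<1 = ⊥-elim (ℕP.<⇒≱ t<1 0<t)
prime-power-factor {p} pp (suc n) t 0<t t<pⁿ⁺¹ with p ℕ∣.∣? t
... | no  p∤t = 0 , t , s≤s z≤n , sym (ℕP.*-identityˡ t) , p∤t
... | yes (ℕ∣.divides q refl) with prime-power-factor pp n q 0<q q<pⁿ
  where
  0<q : 0 < q
  0<q = ℕ.>-nonZero⁻¹ q {{ℕP.m*n≢0⇒m≢0 q {{ℕ.>-nonZero 0<t}}}}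
  q<pⁿ : q < p ^ n
  q<pⁿ = ℕP.*-cancelʳ-< p q (p ^ n) (subst (q ℕ.* p <_) (ℕP.*-comm p (p ^ n)) t<pⁿ⁺¹)
... | k , v , k<n , q≡pᵏv , p∤v = suc k , v , s≤s k<n , t≡pᵏ⁺¹v , p∤v
  where
  t≡pᵏ⁺¹v : q ℕ.* p ≡ p ^ suc k ℕ.* v
  t≡pᵏ⁺¹v = trans (cong (ℕ._* p) q≡pᵏv) (trans (ℕP.*-comm (p ^ k ℕ.* v) p) (sym (ℕP.*-assoc p (p ^ k) v)))

-- The square of the exponential sum

S≡∑ₚ : ∀ p q n → S p q n ≡ ∑ₚ[ z < p ^ n ] e p n (q (+ suc z))
S≡∑ₚ p q n = sumₚ-map-upTo (λ z → e p n (q (+ suc z))) (p ^ n)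

conjS≡∑ₚ : ∀ p q n → conjS p q n ≡ ∑ₚ[ z < p ^ n ] e p n (- q (+ suc z))
conjS≡∑ₚ p q n = sumₚ-map-upTo (λ z → e p n (- q (+ suc z))) (p ^ n)

Δ : (ℤ → ℤ) → ℤ → ℤ → ℤ
Δ q y t = q y - q (y + t)

Δ-zero : ∀ q y → Δ q y (+ 0) ≡ + 0
Δ-zero q y = trans (cong (λ x → q y - q x) (ℤP.+-identityʳ y)) (ℤP.+-inverseʳ (q y))

absSq≈∑-differences : ∀ p n (q : ℤ → ℤ) → 0 < p ^ n →
                      (∀ {x y} → x ≡ y mod p ^ n → q x ≡ q y mod p ^ n) →
  absSq p q n ≈ ∑ₚ[ t < p ^ n ] ∑ₚ[ z < p ^ n ] e p n (Δ q (+ suc z) (+ t)) mod Φ p n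
absSq≈∑-differences p n q 0<N q-cong =
  ≈-trans (≋⇒≈ expand)
  (≈-trans (≈-∑ₚ N λ z _ → ≈-∑ₚ N λ w _ → exponent z w)
           (≋⇒≈ (≋-trans (∑ₚ-cong N λ z _ → ≋-sym (shift z)) (∑ₚ-swap N N _))))
  where
  N = p ^ n
  R : ℤ → ℕ
  R x = reduce x N
  Q : ℕ → ℤ
  Q z = q (+ suc z)
  expand : absSq p q n ≋ ∑ₚ[ z < N ] ∑ₚ[ w < N ] mono (R (Q z) ℕ.+ R (- Q w))
  expand rewrite S≡∑ₚ p q n | conjS≡∑ₚ p q n =
    ≋-trans (∑ₚ-*ₚ-∑ₚ N N _ _) (∑ₚ-cong N λ z _ → ∑ₚ-cong N λ w _ → mono-*ₚ-mono (R (Q z)) (R (- Q w)))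
  exponent : ∀ z w → mono (R (Q z) ℕ.+ R (- Q w)) ≈ e p n (Q z - Q w) mod Φ p n
  exponent z w = mono-cong p n 0<N _ _ (≡mod-trans (≡mod-reflexive (ℤP.pos-+ (R (Q z)) (R (- Q w))))
    (≡mod-+ (≡mod-sym (reduce-≡mod N (Q z) 0<N)) (≡mod-sym (reduce-≡mod N (- Q w) 0<N))))
  shift : ∀ z → ∑ₚ[ t < N ] e p n (Δ q (+ suc z) (+ t)) ≋ ∑ₚ[ w < N ] e p n (Q z - Q w)
  shift z = ≋-trans (∑ₚ-cong N λ t _ → coeffwise λ k → cong (λ r → δ r k) (reduce-cong N _ _ 0<N (same-value t)))
                    (∑ₚ-permute N π λ w → e p n (Q z - Q w))
    where
    π : Permutation N
    π = affine-permutation N (+ z) (+ 1) (+ 1) 0<N (≡mod-refl (+ 1))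
    same-value : ∀ t → Δ q (+ suc z) (+ t) ≡ Q z - Q (Permutation.to π t) mod N
    same-value t = ≡mod-minus (≡mod-refl (Q z)) (q-cong (begin
      + suc z + + t              ≡⟨ ℤP.+-assoc (+ 1) (+ z) (+ t) ⟩
      + 1 + (+ z + + t)          ≡⟨ cong (_+_ (+ 1)) (cong (_+_ (+ z)) (sym (ℤP.*-identityʳ (+ t)))) ⟩
      + 1 + (+ z + + t * + 1)    ≈⟨ ≡mod-+ (≡mod-refl (+ 1)) (reduce-≡mod N (+ z + + t * + 1) 0<N) ⟩
      + 1 + + R (+ z + + t * + 1) ≡⟨ ℤP.pos-+ 1 _ ⟨
      + suc (R (+ z + + t * + 1)) ∎))
      where open ≡mod-Reasoning N

cubic-cong : ∀ a₃ a₂ a₁ a₀ {m x y} → x ≡ y mod m → cubic a₃ a₂ a₁ a₀ x ≡ cubic a₃ a₂ a₁ a₀ y mod m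
cubic-cong a₃ a₂ a₁ a₀ {m} {x} {y} (from-∣ m∣x-y) =
  from-∣ (subst (+ m Signed.∣_) (sym (factor a₃ a₂ a₁ a₀ x y))
                (∣m⇒∣m*n (a₃ * (x * x + x * y + y * y) + a₂ * (x + y) + a₁) m∣x-y))
  where
  factor : ∀ a₃ a₂ a₁ a₀ x y →
    (a₃ * (x * x * x) + a₂ * (x * x) + a₁ * x + a₀) - (a₃ * (y * y * y) + a₂ * (y * y) + a₁ * y + a₀)
      ≡ (x - y) * (a₃ * (x * x + x * y + y * y) + a₂ * (x + y) + a₁)
  factor = solve-∀

cubic-second-difference : ∀ a₃ a₂ a₁ a₀ {p} y (c j P v : ℕ) → + p Signed.∣ a₃ →
  Δ (cubic a₃ a₂ a₁ a₀) (y + + c * + j) (+ P * + v)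
    ≡ Δ (cubic a₃ a₂ a₁ a₀) y (+ P * + v) + + j * - (+ 2 * a₂ * + v) * (+ c * + P) mod p ℕ.* (c ℕ.* P)
cubic-second-difference _ a₂ a₁ a₀ {p} y c j P v (divides A refl) =
  from-∣ (divides K (trans (expanded A a₂ a₁ a₀ (+ p) y (+ c) (+ j) (+ P) (+ v))
                           (cong (K *_) (sym (trans (ℤP.pos-* p (c ℕ.* P)) (cong (_*_ (+ p)) (ℤP.pos-* c P)))))))
  where
  K : ℤ
  K = - (+ v * + j * A * (+ 6 * y + + 3 * (+ c * + j) + + 3 * (+ P * + v)))
  -- The a₂-part of the second difference is exactly -2a₂·cj·Pv; the a₃-part is
  -- -3a₃·cj·Pv·(2y + cj + Pv), a multiple of p·cP because p ∣ a₃.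
  expanded : ∀ A a₂ a₁ a₀ p y c j P v →
    ((A * p) * ((y + c * j) * (y + c * j) * (y + c * j)) + a₂ * ((y + c * j) * (y + c * j)) + a₁ * (y + c * j) + a₀
      - ((A * p) * ((y + c * j + P * v) * (y + c * j + P * v) * (y + c * j + P * v))
         + a₂ * ((y + c * j + P * v) * (y + c * j + P * v)) + a₁ * (y + c * j + P * v) + a₀))
    - ((A * p) * (y * y * y) + a₂ * (y * y) + a₁ * y + a₀
        - ((A * p) * ((y + P * v) * (y + P * v) * (y + P * v)) + a₂ * ((y + P * v) * (y + P * v)) + a₁ * (y + P * v) + a₀)
       + j * - (+ 2 * a₂ * v) * (c * P))
    ≡ - (v * j * A * (+ 6 * y + + 3 * (c * j) + + 3 * (P * v))) * (p * (c * P))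
  expanded = solve-∀

module _ (p : ℕ) (p-prime : Prime p) (3<p : 3 < p) (a₃ a₂ a₁ a₀ : ℤ)
         (p∣a₃ : + p ∣ a₃) (p∤a₂ : ¬ + p ∣ a₂) where

  private
    q : ℤ → ℤ
    q = cubic a₃ a₂ a₁ a₀

    0<p : 0 < p
    0<p = ℕP.<-trans (s≤s z≤n) 3<p

    0<pⁿ : ∀ n → 0 < p ^ n
    0<pⁿ = ℕP.m^n>0 p {{ℕ.>-nonZero 0<p}}

  differences-vanish : ∀ m t → 0 < t → t < p ^ suc m →
                       ∑ₚ[ z < p ^ suc m ] e p (suc m) (Δ q (+ suc z) (+ t)) ≈ [] mod Φ p (suc m)
  differences-vanish m t 0<t t<N with prime-power-factor p-prime (suc m) t 0<t t<N
  ... | k , v , s≤s k≤m , t≡pᵏv , p∤v =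
    ≈-trans (≋⇒≈ digits)
    (≈-trans (≈-∑ₚ P λ y _ → ≈-∑ₚ c λ x _ → progression x y)
             (≋⇒≈ (≋-trans (∑ₚ-cong P λ _ _ → ∑ₚ-zero c) (∑ₚ-zero P))))
    where
    M N P c : ℕ
    M = p ^ m
    N = p ^ suc m
    P = p ^ k
    c = p ^ (m ∸ k)
    cP≡M : c ℕ.* P ≡ M
    cP≡M = trans (sym (ℕP.^-distribˡ-+-* p (m ∸ k) k)) (cong (p ^_) (ℕP.m∸n+n≡m k≤m))
    pcP≡N : p ℕ.* (c ℕ.* P) ≡ N
    pcP≡N = cong (p ℕ.*_) cP≡M
    u : ℤ
    u = - (+ 2 * a₂ * + v)
    -- the only use of p > 3: 2 is invertible modulo p
    p∤u : ¬ p ℕ∣.∣ ℤ.∣ u ∣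
    p∤u p∣u rewrite ℤP.∣-i∣≡∣i∣ (+ 2 * a₂ * + v) | ℤP.abs-* (+ 2 * a₂) (+ v) | ℤP.abs-* (+ 2) a₂
      with euclidsLemma (2 ℕ.* ℤ.∣ a₂ ∣) v p-prime p∣u
    ... | inj₂ p∣v = p∤v p∣v
    ... | inj₁ p∣2a₂ with euclidsLemma 2 ℤ.∣ a₂ ∣ p-prime p∣2a₂
    ...   | inj₁ p∣2  = ℕP.<⇒≱ 3<p (ℕP.≤-trans (ℕ∣.∣⇒≤ p∣2) (ℕP.n≤1+n 2))
    ...   | inj₂ p∣a₂ = p∤a₂ p∣a₂
    w : ℤ
    w = proj₁ (inverse-mod u (prime∤⇒coprime p-prime p∤u))
    uw≡1 : u * w ≡ + 1 mod p
    uw≡1 = proj₂ (inverse-mod u (prime∤⇒coprime p-prime p∤u))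
    F : ℕ → Poly
    F z = e p (suc m) (Δ q (+ suc z) (+ t))
    digits : ∑ₚ N F ≋ ∑ₚ[ y < P ] ∑ₚ[ x < c ] ∑ₚ[ j < p ] F (x ℕ.+ c ℕ.* (j ℕ.+ p ℕ.* y))
    digits = ≋-trans (subst (λ L → ∑ₚ L F ≋ ∑ₚ (c ℕ.* (p ℕ.* P)) F) (trans (reorder c p P) pcP≡N) ≋-refl)
             (≋-trans (∑ₚ-*-range c (p ℕ.* P) F)
             (≋-trans (∑ₚ-*-range p P λ Y → ∑ₚ[ x < c ] F (x ℕ.+ c ℕ.* Y))
                      (∑ₚ-cong P λ y _ → ∑ₚ-swap p c λ j x → F (x ℕ.+ c ℕ.* (j ℕ.+ p ℕ.* y)))))
      where
      reorder : ∀ c p P → c ℕ.* (p ℕ.* P) ≡ p ℕ.* (c ℕ.* P)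
      reorder = ℕS.solve-∀
    step : ∀ x j y → Δ q (+ suc (x ℕ.+ c ℕ.* (j ℕ.+ p ℕ.* y))) (+ t)
                   ≡ Δ q (+ suc (x ℕ.+ c ℕ.* (p ℕ.* y))) (+ t) + + j * u * + M mod N
    step x j y = begin
      Δ q (+ suc (x ℕ.+ c ℕ.* (j ℕ.+ p ℕ.* y))) (+ t)   ≡⟨ cong₂ (Δ q) point t-split ⟩
      Δ q (y₀ + + c * + j) (+ P * + v)                 ≈⟨ subst (_≡_mod_ _ _) pcP≡N
                                                             (cubic-second-difference a₃ a₂ a₁ a₀ y₀ c j P v (Signed.∣ᵤ⇒∣ p∣a₃)) ⟩
      Δ q y₀ (+ P * + v) + + j * u * (+ c * + P)       ≡⟨ cong₂ (λ T L → Δ q y₀ T + + j * u * L) t-split M-split ⟨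
      Δ q y₀ (+ t) + + j * u * + M                     ∎
      where
      open ≡mod-Reasoning N
      y₀ : ℤ
      y₀ = + suc (x ℕ.+ c ℕ.* (p ℕ.* y))
      shift : ∀ x c j p y → suc (x ℕ.+ c ℕ.* (j ℕ.+ p ℕ.* y)) ≡ suc (x ℕ.+ c ℕ.* (p ℕ.* y)) ℕ.+ c ℕ.* j
      shift = ℕS.solve-∀
      point : + suc (x ℕ.+ c ℕ.* (j ℕ.+ p ℕ.* y)) ≡ y₀ + + c * + j
      point = trans (cong +_ (shift x c j p y)) (trans (ℤP.pos-+ _ (c ℕ.* j)) (cong (_+_ y₀) (ℤP.pos-* c j)))
      t-split : + t ≡ + P * + v
      t-split = trans (cong +_ t≡pᵏv) (ℤP.pos-* P v)
      M-split : + M ≡ + c * + P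
      M-split = trans (cong +_ (sym cP≡M)) (ℤP.pos-* c P)
    progression : ∀ x y → ∑ₚ[ j < p ] F (x ℕ.+ c ℕ.* (j ℕ.+ p ℕ.* y)) ≈ [] mod Φ p (suc m)
    progression x y = ∑ₚ-progression≈[] p m (λ j → Δ q (+ suc (x ℕ.+ c ℕ.* (j ℕ.+ p ℕ.* y))) (+ t))
                        (Δ q (+ suc (x ℕ.+ c ℕ.* (p ℕ.* y))) (+ t)) u w 0<p uw≡1 (λ j _ → step x j y)

  differences-at-zero : ∀ n → ∑ₚ[ z < p ^ n ] e p n (Δ q (+ suc z) (+ 0)) ≋ const (+ (p ^ n))
  differences-at-zero n = coeffwise λ k → begin
    coeff (∑ₚ[ z < N ] e p n (Δ q (+ suc z) (+ 0))) k     ≡⟨ coeff-∑ₚ N _ k ⟩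
    ∑[ z < N ] δ (reduce (Δ q (+ suc z) (+ 0)) N) k       ≡⟨ ∑-cong N (λ z _ → cong (λ r → δ r k) (reduce-0 z)) ⟩
    ∑[ z < N ] δ 0 k                                      ≡⟨ ∑-const N (δ 0 k) ⟩
    + N * δ 0 k                                           ≡⟨ constant-term k ⟩
    coeff (const (+ N)) k                                 ∎
    where
    open ≡-Reasoning
    N = p ^ n
    reduce-0 : ∀ z → reduce (Δ q (+ suc z) (+ 0)) N ≡ 0
    reduce-0 z = reduce-unique N _ 0 (0<pⁿ n) (0<pⁿ n) (≡mod-reflexive (Δ-zero q (+ suc z)))
    constant-term : ∀ k → + N * δ 0 k ≡ coeff (const (+ N)) k
    constant-term zero    = ℤP.*-identityʳ (+ N)
    constant-term (suc k) = ℤP.*-zeroʳ (+ N)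

  absSq≈pⁿ : ∀ n → absSq p q n ≈ const (+ (p ^ n)) mod Φ p n
  absSq≈pⁿ n = ≈-trans (absSq≈∑-differences p n q (0<pⁿ n) (cubic-cong a₃ a₂ a₁ a₀))
                       (∑ₚ≈head (p ^ n) _ (0<pⁿ n) (≋⇒≈ (differences-at-zero n)) (vanish n))
    where
    vanish : ∀ n t → 0 < t → t < p ^ n → ∑ₚ[ z < p ^ n ] e p n (Δ q (+ suc z) (+ t)) ≈ [] mod Φ p n
    vanish zero    t 0<t t<1 = ⊥-elim (ℕP.<⇒≱ t<1 0<t)
    vanish (suc m) t         = differences-vanish m t

mainTheorem10 : (p : ℕ) → Prime p → 3 < p → (n : ℕ) → (a₃ a₂ a₁ a₀ : ℤ) →
    (+ p) ∣ a₃ → ¬ ((+ p) ∣ a₂) →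
    absSq p (cubic a₃ a₂ a₁ a₀) n ≈[ p ^ n ] const (+ (p ^ n))
mainTheorem10 p p-prime 3<p n a₃ a₂ a₁ a₀ p∣a₃ p∤a₂ = quotient , equality
  where open _≈_mod_ (absSq≈pⁿ p p-prime 3<p a₃ a₂ a₁ a₀ p∣a₃ p∤a₂ n)
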